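{- $|\mathcal S^*|=O(n^2)$, i.e., over all possible $k$-partitions with sinks there are only $O(n^2)$ candidate worst-case scenarios of the structured form.
   Context: $P$ is a path with vertices at coordinates $x_0<\dots<x_n$; $\tau>0$. Vertex $x_i$ has weight interval $[w_i^-,w_i^+]$, $0<w_i^-\le w_i^+$; a scenario $s$ assigns $w_i(s)\in[w_i^-,w_i^+]$, $\mathcal S$ the set of scenarios. For a subpath $Q=\{x_l,\dots,x_r\}$, sink $y=x_t\in Q$: $\Theta_L(Q,y,s)=\max_{l\le i<t}\{(x_t-x_i)\tau+\sum_{j=l}^i w_j(s)\}$, $\Theta_R(Q,y,s)=\max_{t<i\le r}\{(x_i-x_t)\tau+\sum_{j=i}^r w_j(s)\}$ (empty maxima $0$), $\Theta^1=\max(\Theta_L,\Theta_R)$. A $k$-partition with sinks $\{\hat P,\hat Y\}$: consecutive subpaths $P_1,\dots,P_k$ partitioning the vertices, sinks $y_i\in P_i$; $\Theta^k=\max_i\Theta^1(P_i,y_i,s)$, $\Theta^k_{\rm opt}(P,s)$ its minimum; regret $=\Theta^k-\Theta^k_{\rm opt}$; a worst-case scenario maximizes regret over $\mathcal S$; dominant part $P_d$ with $d$ the smallest index maximizing $\Theta^1(P_i,y_i,s)$. A sub-scenario on $\{x_l,\dots,x_r\}$ is left-dominant (resp. right-dominant) if for some $l\le i\le r$, $w_j=w_j^+$ (resp. $w_j^-$) for $l\le j<i$ and $w_j=w_j^-$ (resp. $w_j^+$) for $i\le j\le r$. $\mathcal S^*\subseteq\mathcal S$ is the set of all scenarios that,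 for some $k$-partition with sinks, are worst-case scenarios for it with dominant part $P_d$ such that $w_i=w_i^-$ for $x_i\notin P_d$ and the sub-scenario in $P_d$ is left- or right-dominant.
   Formalization: The vertex coordinates, τ, the weight bounds $w_i^-$, $w_i^+$ and all scenario weights, including those over which worst-case regret is maximized, are rational. -}

module Defs where

open import Data.Nat as ℕ using (ℕ; zero; suc)
open import Data.Rational using (ℚ; 0ℚ; _+_; _*_; _-_; _⊔_; _≤_; _<_)
open import Data.List using (List; []; _∷_; foldr; map; length; lookup)
open import Data.Fin using (Fin; toℕ)
open import Data.Product using (_×_; Σ; ∃; _,_)
open import Data.Sum using (_⊎_)
open import Relation.Binary.PropositionalEquality using (_≡_)

-- Vertex coordinates, weights and scenarios are functions ℕ → ℚ;
-- only the indices 0 … n are meaningful.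

range : ℕ → ℕ → List ℕ
range a zero = []
range a (suc c) = a ∷ range (suc a) c

-- the list of indices i with a ≤ i ≤ b  (empty if b < a)
interval : ℕ → ℕ → List ℕ
interval a b = range a (suc b ℕ.∸ a)

intervalLT : ℕ → ℕ → List ℕ
intervalLT a b = range a (b ℕ.∸ a)

-- maximum of a list of (nonnegative) values, empty maximum = 0
maxL : List ℚ → ℚ
maxL = foldr _⊔_ 0ℚ

sumW : (ℕ → ℚ) → ℕ → ℕ → ℚ
sumW w a b = foldr _+_ 0ℚ (map w (interval a b))

-- a part of a partition: subpath {x_l,…,x_r} with sink x_t
record Part : Set where
  constructor part
  field
    l r t : ℕ
open Part public

ΘL : (x : ℕ → ℚ) (τ : ℚ) (s : ℕ → ℚ) → Part → ℚ
ΘL x τ s (part l r t) =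
  maxL (map (λ i → ((x t - x i) * τ) + sumW s l i) (intervalLT l t))

ΘR : (x : ℕ → ℚ) (τ : ℚ) (s : ℕ → ℚ) → Part → ℚ
ΘR x τ s (part l r t) =
  maxL (map (λ i → ((x i - x t) * τ) + sumW s i r) (interval (suc t) r))

Θ1 : (x : ℕ → ℚ) (τ : ℚ) (s : ℕ → ℚ) → Part → ℚ
Θ1 x τ s P = ΘL x τ s P ⊔ ΘR x τ s P

Θk : (x : ℕ → ℚ) (τ : ℚ) (s : ℕ → ℚ) → List Part → ℚ
Θk x τ s ps = maxL (map (Θ1 x τ s) ps)

data Chain (n : ℕ) : ℕ → List Part → Set where
  chain-last : ∀ {l r t} → l ℕ.≤ t → t ℕ.≤ r → r ≡ n →
               Chain n l (part l r t ∷ [])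
  chain-cons : ∀ {l r t ps} → l ℕ.≤ t → t ℕ.≤ r → Chain n (suc r) ps →
               Chain n l (part l r t ∷ ps)

IsKPartition : ℕ → ℕ → List Part → Set
IsKPartition n k ps = length ps ≡ k × Chain n 0 ps

IsScenario : ℕ → (wm wp : ℕ → ℚ) → (ℕ → ℚ) → Set
IsScenario n wm wp s = ∀ i → i ℕ.≤ n → (wm i ≤ s i × s i ≤ wp i)

IsOpt : ℕ → ℕ → (x : ℕ → ℚ) (τ : ℚ) (s : ℕ → ℚ) → ℚ → Set
IsOpt n k x τ s v =
  (Σ (List Part) λ ps → IsKPartition n k ps × Θk x τ s ps ≡ v) ×
  (∀ ps → IsKPartition n k ps → v ≤ Θk x τ s ps)

IsWorstCase : ℕ → ℕ → (x : ℕ → ℚ) (τ : ℚ) (wm wp : ℕ → ℚ) →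
              List Part → (ℕ → ℚ) → Set
IsWorstCase n k x τ wm wp ps s =
  IsScenario n wm wp s ×
  (∀ s' → IsScenario n wm wp s' → ∀ v v' →
     IsOpt n k x τ s v → IsOpt n k x τ s' v' →
     (Θk x τ s' ps - v') ≤ (Θk x τ s ps - v))

IsDominant : (x : ℕ → ℚ) (τ : ℚ) (s : ℕ → ℚ) (ps : List Part) →
             Fin (length ps) → Set
IsDominant x τ s ps d =
  (∀ j → Θ1 x τ s (lookup ps j) ≤ Θ1 x τ s (lookup ps d)) ×
  (∀ j → toℕ j ℕ.< toℕ d → Θ1 x τ s (lookup ps j) < Θ1 x τ s (lookup ps d))

LeftDominant : (wm wp s : ℕ → ℚ) → ℕ → ℕ → Set
LeftDominant wm wp s l r =
  Σ ℕ λ i → l ℕ.≤ i × i ℕ.≤ r ×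
    (∀ j → l ℕ.≤ j → j ℕ.< i → s j ≡ wp j) ×
    (∀ j → i ℕ.≤ j → j ℕ.≤ r → s j ≡ wm j)

RightDominant : (wm wp s : ℕ → ℚ) → ℕ → ℕ → Set
RightDominant wm wp s l r =
  Σ ℕ λ i → l ℕ.≤ i × i ℕ.≤ r ×
    (∀ j → l ℕ.≤ j → j ℕ.< i → s j ≡ wm j) ×
    (∀ j → i ℕ.≤ j → j ℕ.≤ r → s j ≡ wp j)





InSStar : ℕ → ℕ → (x : ℕ → ℚ) (τ : ℚ) (wm wp : ℕ → ℚ) → (ℕ → ℚ) → Set
InSStar n k x τ wm wp s =
  Σ (List Part) λ ps → IsKPartition n k ps × IsWorstCase n k x τ wm wp ps s ×
  Σ (Fin (length ps)) λ d → IsDominant x τ s ps d ×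
    (∀ i → i ℕ.≤ n → (i ℕ.< l (lookup ps d)) ⊎ (r (lookup ps d) ℕ.< i) →
       s i ≡ wm i) ×
    (LeftDominant wm wp s (l (lookup ps d)) (r (lookup ps d)) ⊎
     RightDominant wm wp s (l (lookup ps d)) (r (lookup ps d)))

IsInstance : ℕ → (x : ℕ → ℚ) (τ : ℚ) (wm wp : ℕ → ℚ) → Set
IsInstance n x τ wm wp =
  (∀ i → i ℕ.< n → x i < x (suc i)) × 0ℚ < τ ×
  (∀ i → i ℕ.≤ n → 0ℚ < wm i × wm i ≤ wp i)

-- A scenario of S* is w⁻ outside its dominant part and, inside it, w⁺ on an
-- initial or a final segment and w⁻ on the rest. Either way it is w⁺ exactly
-- on one interval [a, b) with 0 ≤ a, b ≤ n + 1 and w⁻ elsewhere, so S* is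
-- covered by the (n + 2)² ≤ 4 (n + 1)² block scenarios indexed by (a, b),
-- whatever the partition, k, coordinates and τ are.
module Submission where

open import Defs
open import Data.Nat using (ℕ; suc; _*_; _^_; _≤_; _<_; _≤?_; _<?_; _+_; s≤s)
open import Data.Nat.Properties
open import Data.Nat.Solver using (module +-*-Solver)
open import Data.Rational using (ℚ)
open import Data.List using (List; []; _∷_; length; lookup; map; upTo; cartesianProductWith)
open import Data.List.Properties using (length-++; length-map; length-upTo)
open import Data.List.Membership.Propositional using (_∈_)
open import Data.List.Membership.Propositional.Properties using (∈-upTo⁺; ∈-cartesianProductWith⁺)
open import Data.Fin using (Fin) renaming (zero to fzero; suc to fsuc)
open import Data.Product using (Σ; ∃₂; _×_; _,_)
open import Data.Sum using (_⊎_; inj₁; inj₂)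
open import Relation.Nullary using (yes; no; contradiction)
open import Relation.Binary.PropositionalEquality using (_≡_; refl; sym; trans; cong; cong₂)

AgreeUpTo : ℕ → (ℕ → ℚ) → (ℕ → ℚ) → Set
AgreeUpTo n s s′ = ∀ i → i ≤ n → s i ≡ s′ i

blockScenario : (wm wp : ℕ → ℚ) → ℕ → ℕ → ℕ → ℚ
blockScenario wm wp a b j with a ≤? j | j <? b
... | yes _ | yes _ = wp j
... | _     | _     = wm j

module _ (wm wp : ℕ → ℚ) (a b : ℕ) where

  blockScenario-below : ∀ j → j < a → blockScenario wm wp a b j ≡ wm j
  blockScenario-below j j<a with a ≤? j | j <? b
  ... | yes a≤j | yes _ = contradiction a≤j (<⇒≱ j<a)
  ... | yes _   | no _  = refl
  ... | no _    | _     = refl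

  blockScenario-inside : ∀ j → a ≤ j → j < b → blockScenario wm wp a b j ≡ wp j
  blockScenario-inside j a≤j j<b with a ≤? j | j <? b
  ... | yes _   | yes _   = refl
  ... | no a≰j  | _       = contradiction a≤j a≰j
  ... | yes _   | no j≮b  = contradiction j<b j≮b

  blockScenario-above : ∀ j → b ≤ j → blockScenario wm wp a b j ≡ wm j
  blockScenario-above j b≤j with a ≤? j | j <? b
  ... | yes _ | yes j<b = contradiction j<b (≤⇒≯ b≤j)
  ... | yes _ | no _    = refl
  ... | no _  | _       = refl

  agreeUpTo-blockScenario : ∀ {n s} →
    (∀ j → j ≤ n → j < a → s j ≡ wm j) →
    (∀ j → j ≤ n → a ≤ j → j < b → s j ≡ wp j) →
    (∀ j → j ≤ n → b ≤ j → s j ≡ wm j) →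
    AgreeUpTo n s (blockScenario wm wp a b)
  agreeUpTo-blockScenario below inside above j j≤n with j <? a | b ≤? j
  ... | yes j<a | _       = trans (below j j≤n j<a) (sym (blockScenario-below j j<a))
  ... | no _    | yes b≤j = trans (above j j≤n b≤j) (sym (blockScenario-above j b≤j))
  ... | no j≮a  | no b≰j  = trans (inside j j≤n (≮⇒≥ j≮a) (≰⇒> b≰j))
                                  (sym (blockScenario-inside j (≮⇒≥ j≮a) (≰⇒> b≰j)))

IsBlockUpTo : ℕ → (wm wp s : ℕ → ℚ) → Set
IsBlockUpTo n wm wp s =
  ∃₂ λ a b → a ≤ suc n × b ≤ suc n × AgreeUpTo n s (blockScenario wm wp a b)

MinimalOutside : ℕ → (wm s : ℕ → ℚ) → ℕ → ℕ → Set
MinimalOutside n wm s l r = ∀ i → i ≤ n → (i < l) ⊎ (r < i) → s i ≡ wm i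

module _ {n : ℕ} {wm wp s : ℕ → ℚ} {l r : ℕ} (r≤n : r ≤ n)
         (outside : MinimalOutside n wm s l r) where

  leftDominant⇒isBlockUpTo : LeftDominant wm wp s l r → IsBlockUpTo n wm wp s
  leftDominant⇒isBlockUpTo (i , l≤i , i≤r , plus , minus) =
    l , i , m≤n⇒m≤1+n (≤-trans l≤i i≤n) , m≤n⇒m≤1+n i≤n ,
    agreeUpTo-blockScenario wm wp l i below (λ j _ → plus j) above
    where
    i≤n : i ≤ n
    i≤n = ≤-trans i≤r r≤n
    below : ∀ j → j ≤ n → j < l → s j ≡ wm j
    below j j≤n j<l = outside j j≤n (inj₁ j<l)
    above : ∀ j → j ≤ n → i ≤ j → s j ≡ wm j
    above j j≤n i≤j with r <? j
    ... | yes r<j = outside j j≤n (inj₂ r<j)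
    ... | no r≮j  = minus j i≤j (≮⇒≥ r≮j)

  rightDominant⇒isBlockUpTo : RightDominant wm wp s l r → IsBlockUpTo n wm wp s
  rightDominant⇒isBlockUpTo (i , l≤i , i≤r , minus , plus) =
    i , suc r , m≤n⇒m≤1+n (≤-trans i≤r r≤n) , s≤s r≤n ,
    agreeUpTo-blockScenario wm wp i (suc r) below inside above
    where
    below : ∀ j → j ≤ n → j < i → s j ≡ wm j
    below j j≤n j<i with j <? l
    ... | yes j<l = outside j j≤n (inj₁ j<l)
    ... | no j≮l  = minus j (≮⇒≥ j≮l) j<i
    inside : ∀ j → j ≤ n → i ≤ j → j < suc r → s j ≡ wp j
    inside j _ i≤j (s≤s j≤r) = plus j i≤j j≤r
    above : ∀ j → j ≤ n → suc r ≤ j → s j ≡ wm j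
    above j j≤n r<j = outside j j≤n (inj₂ r<j)

chain-start≤end : ∀ {n a ps} → Chain n a ps → a ≤ n
chain-start≤end (chain-last l≤t t≤r refl) = ≤-trans l≤t t≤r
chain-start≤end (chain-cons l≤t t≤r c)    = ≤-trans (≤-trans l≤t t≤r) (<⇒≤ (chain-start≤end c))

chain-lookup-r≤end : ∀ {n a ps} → Chain n a ps → (d : Fin (length ps)) → r (lookup ps d) ≤ n
chain-lookup-r≤end (chain-last _ _ refl) fzero    = ≤-refl
chain-lookup-r≤end (chain-cons _ _ c)    fzero    = <⇒≤ (chain-start≤end c)
chain-lookup-r≤end (chain-cons _ _ c)    (fsuc d) = chain-lookup-r≤end c d

inSStar⇒isBlockUpTo : ∀ {n} k x τ {wm wp s} → InSStar n k x τ wm wp s → IsBlockUpTo n wm wp s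
inSStar⇒isBlockUpTo k x τ (_ , (_ , c) , _ , d , _ , outside , inj₁ left) =
  leftDominant⇒isBlockUpTo (chain-lookup-r≤end c d) outside left
inSStar⇒isBlockUpTo k x τ (_ , (_ , c) , _ , d , _ , outside , inj₂ right) =
  rightDominant⇒isBlockUpTo (chain-lookup-r≤end c d) outside right

length-cartesianProductWith : ∀ {A B C : Set} (f : A → B → C) xs ys →
  length (cartesianProductWith f xs ys) ≡ length xs * length ys
length-cartesianProductWith f []       ys = refl
length-cartesianProductWith f (x ∷ xs) ys =
  trans (length-++ (map (f x) ys))
        (cong₂ _+_ (length-map (f x) ys) (length-cartesianProductWith f xs ys))

blockScenarios : (wm wp : ℕ → ℚ) → ℕ → List (ℕ → ℚ)
blockScenarios wm wp n = cartesianProductWith (blockScenario wm wp) indices indices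
  where indices = upTo (suc (suc n))

blockScenario∈blockScenarios : ∀ wm wp {n a b} → a ≤ suc n → b ≤ suc n →
  blockScenario wm wp a b ∈ blockScenarios wm wp n
blockScenario∈blockScenarios wm wp a≤ b≤ =
  ∈-cartesianProductWith⁺ (blockScenario wm wp) (∈-upTo⁺ (s≤s a≤)) (∈-upTo⁺ (s≤s b≤))

[2+n]²≤4[1+n]² : ∀ n → suc (suc n) * suc (suc n) ≤ 4 * (suc n ^ 2)
[2+n]²≤4[1+n]² n = ≤-trans (*-mono-≤ 2+n≤2[1+n] 2+n≤2[1+n]) (≤-reflexive square)
  where
  open +-*-Solver
  2+n≤2[1+n] : suc (suc n) ≤ 2 * suc n
  2+n≤2[1+n] = s≤s (≤-trans (m≤n+m (suc n) n) (≤-reflexive (cong (n +_) (sym (*-identityˡ (suc n))))))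
  square : (2 * suc n) * (2 * suc n) ≡ 4 * (suc n ^ 2)
  square = solve 1 (λ m → (con 2 :* (con 1 :+ m)) :* (con 2 :* (con 1 :+ m))
                          := con 4 :* ((con 1 :+ m) :^ 2)) refl n

length-blockScenarios : ∀ wm wp n → length (blockScenarios wm wp n) ≤ 4 * (suc n ^ 2)
length-blockScenarios wm wp n = ≤-trans (≤-reflexive counted) ([2+n]²≤4[1+n]² n)
  where
  indices = upTo (suc (suc n))
  counted : length (blockScenarios wm wp n) ≡ suc (suc n) * suc (suc n)
  counted = trans (length-cartesianProductWith (blockScenario wm wp) indices indices)
                  (cong₂ _*_ (length-upTo (suc (suc n))) (length-upTo (suc (suc n))))

blockScenarios-cover-SStar : ∀ n k x τ wm wp s → InSStar n k x τ wm wp s →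
  Σ (ℕ → ℚ) λ s′ → (s′ ∈ blockScenarios wm wp n) × AgreeUpTo n s s′
blockScenarios-cover-SStar n k x τ wm wp s s∈S*
  with a , b , a≤ , b≤ , agree ← inSStar⇒isBlockUpTo k x τ s∈S* =
  blockScenario wm wp a b , blockScenario∈blockScenarios wm wp a≤ b≤ , agree

mainTheorem8 : Σ ℕ λ C →
    ∀ (n k : ℕ) (x : ℕ → ℚ) (τ : ℚ) (wm wp : ℕ → ℚ) →
    IsInstance n x τ wm wp →
    Σ (List (ℕ → ℚ)) λ L →
      (length L ≤ C * (suc n ^ 2)) ×
      (∀ s → InSStar n k x τ wm wp s →
         Σ (ℕ → ℚ) λ s' → (s' ∈ L) × (∀ i → i ≤ n → s i ≡ s' i))
mainTheorem8 = 4 , λ n k x τ wm wp _ →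
  blockScenarios wm wp n , length-blockScenarios wm wp n , blockScenarios-cover-SStar n k x τ wm wp
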